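{- If $k$ is an integer with $k \equiv 2 \pmod 4$ and $k \geq 6$, then $g_{\mathbb{Z}_2}(k) = 8$.
   Context: For a ring $R$ and an integer $k > 1$, let $R^k$ denote the additive semigroup generated by all $k$-th powers of elements of $R$. The Waring number $g_R(k)$ is the smallest positive integer such that every element of $R^k$ can be written as a sum of at most $g_R(k)$ $k$-th powers of elements of $R$. $\mathbb{Z}_2$ denotes the ring of $2$-adic integers. -}

module Defs where

open import Data.Nat using (ℕ; zero; suc; _+_; _*_; _^_; _≤_; _<_)
open import Data.Nat.DivMod using (_%_)
open import Data.Nat.Properties using (m^n≢0)
open import Data.List using (List; length; map)
open import Data.Nat.ListAction using (sum)
open import Data.Product using (Σ; _×_; ∃-syntax)
open import Relation.Binary.PropositionalEquality using (_≡_)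
open import Relation.Nullary using (¬_)

mod2^ : ℕ → ℕ → ℕ
mod2^ n x = _%_ x (2 ^ n) {{m^n≢0 2 n}}

-- The 2-adic integers ℤ₂ = lim← ℤ/2^n ℤ : a coherent sequence of residues
-- (residue n) ∈ {0,…,2^n - 1}, with residue (n+1) ≡ residue n (mod 2^n).
record ℤ₂ : Set where
  constructor mkℤ₂
  field
    residue : ℕ → ℕ
    bounded : ∀ n → residue n < 2 ^ n
    coherent : ∀ n → mod2^ n (residue (suc n)) ≡ residue n
open ℤ₂ public

_≈₂_ : ℤ₂ → ℤ₂ → Set
x ≈₂ y = ∀ n → residue x n ≡ residue y n

-- Residue mod 2^n of the ring element  x₁^k + ... + x_m^k  (ring operations of ℤ₂
-- are computed levelwise in ℤ/2^n).
powSumResidue : ℕ → List ℤ₂ → ℕ → ℕ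
powSumResidue k xs n = mod2^ n (sum (map (λ x → residue x n ^ k) xs))

IsSumOfPowers : ℕ → List ℤ₂ → ℤ₂ → Set
IsSumOfPowers k xs y = ∀ n → powSumResidue k xs n ≡ residue y n

InPowerSemigroup : ℕ → ℤ₂ → Set
InPowerSemigroup k y = ∃[ xs ] (1 ≤ length xs × IsSumOfPowers k xs y)

SumOfAtMost : ℕ → ℕ → ℤ₂ → Set
SumOfAtMost k m y = ∃[ xs ] (length xs ≤ m × IsSumOfPowers k xs y)

WaringBound : ℕ → ℕ → Set
WaringBound k m = ∀ y → InPowerSemigroup k y → SumOfAtMost k m y

WaringNumberIs : ℕ → ℕ → Set
WaringNumberIs k g =
  (1 ≤ g) × WaringBound k g × (∀ m → 1 ≤ m → m < g → ¬ WaringBound k m)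

{-# OPTIONS --safe #-}
-- Write k = 2m with m odd.  For odd u the binomial theorem gives
-- (u + 2^(n+2))^k ≡ u^k + 2^(n+3) (mod 2^(n+4)), since k·2^(n+2) = 2^(n+3)·m.
-- So if u^k + c ≡ y (mod 2^(n+3)), then one of u and u + 2^(n+2) solves the
-- congruence modulo 2^(n+4).  Starting from u = 1, with c < 8 chosen so that
-- 1 + c ≡ y (mod 8), the lifts converge to x ∈ ℤ₂ with y = x^k + c·1^k: every
-- 2-adic integer is a sum of at most 8 k-th powers.
-- Conversely, for even k ≥ 6 every x^k is ≡ 1 (mod 8) or ≡ 0 (mod 64), so a sum
-- of fewer than eight k-th powers is never ≡ 8 (mod 64), while 8 = 1^k + ⋯ + 1^k.
module Submission where

open import Defs
open import Data.Nat using (ℕ; _≤_)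
open import Data.Nat.DivMod using (_%_)
open import Relation.Binary.PropositionalEquality using (_≡_)

open import Data.Nat using (suc; zero; _+_; _*_; _∸_; _^_; _<_; z≤n; s≤s; NonZero)
open import Data.Nat.Properties
open import Data.Nat.DivMod
open import Data.Nat.Divisibility
  using (_∣_; divides; ∣-refl; ∣-trans; *-pres-∣; m∣m*n; n∣m*n; ∣m∣n⇒∣m+n; m%n≡0⇒n∣m; n∣m⇒m%n≡0; ∣n∣m%n⇒∣m)
open import Data.Nat.ListAction using (sum)
open import Data.Nat.Tactic.RingSolver using (solve-∀)
open import Algebra.Properties.CommutativeSemigroup +-commutativeSemigroup using (xy∙z≈xz∙y)
open import Data.List using ([]; _∷_; length; map; replicate)
open import Data.List.Properties using (length-replicate)
open import Data.Product using (∃; ∃-syntax; _×_; _,_; proj₁; proj₂)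
open import Data.Sum as Sum using (_⊎_; inj₁; inj₂)
open import Relation.Nullary using (¬_; contradiction)
open import Relation.Binary.PropositionalEquality
  using (_≢_; refl; sym; trans; cong; subst; module ≡-Reasoning)
open ≡-Reasoning

+-congˡ-% : ∀ {m n} o N .{{_ : NonZero N}} → m % N ≡ n % N → (o + m) % N ≡ (o + n) % N
+-congˡ-% {m} {n} o N m≡n = begin
  (o + m) % N          ≡⟨ %-distribˡ-+ o m N ⟩
  (o % N + m % N) % N  ≡⟨ cong (λ r → (o % N + r) % N) m≡n ⟩
  (o % N + n % N) % N  ≡⟨ %-distribˡ-+ o n N ⟨
  (o + n) % N          ∎

+-congʳ-% : ∀ {m n} o N .{{_ : NonZero N}} → m % N ≡ n % N → (m + o) % N ≡ (n + o) % N
+-congʳ-% {m} {n} o N m≡n = begin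
  (m + o) % N          ≡⟨ %-distribˡ-+ m o N ⟩
  (m % N + o % N) % N  ≡⟨ cong (λ r → (r + o % N) % N) m≡n ⟩
  (n % N + o % N) % N  ≡⟨ %-distribˡ-+ n o N ⟨
  (n + o) % N          ∎

%-distribˡ-^ : ∀ m e N .{{_ : NonZero N}} → m ^ e % N ≡ (m % N) ^ e % N
%-distribˡ-^ m zero    N = refl
%-distribˡ-^ m (suc e) N = begin
  m * m ^ e % N                      ≡⟨ %-distribˡ-* m (m ^ e) N ⟩
  m % N * (m ^ e % N) % N            ≡⟨ cong (λ r → m % N * r % N) (%-distribˡ-^ m e N) ⟩
  m % N * ((m % N) ^ e % N) % N      ≡⟨ cong (λ r → r * ((m % N) ^ e % N) % N) (m%n%n≡m%n m N) ⟨
  m % N % N * ((m % N) ^ e % N) % N  ≡⟨ %-distribˡ-* (m % N) ((m % N) ^ e) N ⟨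
  m % N * (m % N) ^ e % N            ∎

module _ (n : ℕ) .{{_ : NonZero n}} where
  private instance
    2n≢0 : NonZero (2 * n)
    2n≢0 = m*n≢0 2 n

  m<2n⇒m≡m%n∨m≡m%n+n : ∀ {m} → m < 2 * n → m ≡ m % n ⊎ m ≡ m % n + n
  m<2n⇒m≡m%n∨m≡m%n+n {m} m<2n with m / n | m<n*o⇒m/o<n {m} {2} {n} m<2n | m≡m%n+[m/n]*n m n
  ... | 0           | _                | m≡ = inj₁ (trans m≡ (+-identityʳ (m % n)))
  ... | 1           | _                | m≡ = inj₂ (trans m≡ (cong (m % n +_) (+-identityʳ n)))
  ... | suc (suc _) | s≤s (s≤s ())     | _

  m%n≡o%n⇒m≡o∨[m+n]%2n≡o : ∀ {m o} → m < 2 * n → o < 2 * n → m % n ≡ o % n →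
                            m ≡ o ⊎ (m + n) % (2 * n) ≡ o
  m%n≡o%n⇒m≡o∨[m+n]%2n≡o {m} {o} m<2n o<2n m≡o
    with m<2n⇒m≡m%n∨m≡m%n+n m<2n | m<2n⇒m≡m%n∨m≡m%n+n o<2n
  ... | inj₁ m≡ | inj₁ o≡ = inj₁ (trans m≡ (trans m≡o (sym o≡)))
  ... | inj₂ m≡ | inj₂ o≡ = inj₁ (trans m≡ (trans (cong (_+ n) m≡o) (sym o≡)))
  ... | inj₁ m≡ | inj₂ o≡ = inj₂ (begin
    (m + n) % (2 * n)      ≡⟨ cong (λ x → (x + n) % (2 * n)) (trans m≡ m≡o) ⟩
    (o % n + n) % (2 * n)  ≡⟨ cong (_% (2 * n)) o≡ ⟨
    o % (2 * n)            ≡⟨ m<n⇒m%n≡m o<2n ⟩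
    o                      ∎)
  ... | inj₂ m≡ | inj₁ o≡ = inj₂ (begin
    (m + n) % (2 * n)        ≡⟨ cong (λ x → (x + n) % (2 * n)) (trans m≡ (cong (_+ n) (trans m≡o (sym o≡)))) ⟩
    (o + n + n) % (2 * n)    ≡⟨ cong (_% (2 * n)) (+-assoc o n n) ⟩
    (o + (n + n)) % (2 * n)  ≡⟨ cong (λ x → (o + (n + x)) % (2 * n)) (+-identityʳ n) ⟨
    (o + 2 * n) % (2 * n)    ≡⟨ [m+n]%n≡m%n o (2 * n) ⟩
    o % (2 * n)              ≡⟨ m<n⇒m%n≡m o<2n ⟩
    o                        ∎)

  m%n≡o%n⇒m%2n≡o∨[m+n]%2n≡o : ∀ {m o} → m % n ≡ o % n → o < 2 * n →
                              m % (2 * n) ≡ o ⊎ (m + n) % (2 * n) ≡ o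
  m%n≡o%n⇒m%2n≡o∨[m+n]%2n≡o {m} {o} m≡o o<2n =
    Sum.map₂ (trans (+-congʳ-% n (2 * n) (sym (m%n%n≡m%n m (2 * n)))))
      (m%n≡o%n⇒m≡o∨[m+n]%2n≡o (m%n<n m (2 * n)) o<2n (trans (m∣n⇒o%n%m≡o%m n (2 * n) m (n∣m*n 2)) m≡o))

m%2≡0∨m%2≡1 : ∀ m → m % 2 ≡ 0 ⊎ m % 2 ≡ 1
m%2≡0∨m%2≡1 m with m % 2 | m%n<n m 2
... | 0           | _            = inj₁ refl
... | 1           | _            = inj₂ refl
... | suc (suc _) | s≤s (s≤s ())

m%2≡1⇒m^e%2≡1 : ∀ m e → m % 2 ≡ 1 → m ^ e % 2 ≡ 1
m%2≡1⇒m^e%2≡1 m e m-odd = begin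
  m ^ e % 2        ≡⟨ %-distribˡ-^ m e 2 ⟩
  (m % 2) ^ e % 2  ≡⟨ cong (λ r → r ^ e % 2) m-odd ⟩
  1 ^ e % 2        ≡⟨ cong (_% 2) (^-zeroˡ e) ⟩
  1                ∎

m%2≡1⇒m^2%8≡1 : ∀ m → m % 2 ≡ 1 → m ^ 2 % 8 ≡ 1
m%2≡1⇒m^2%8≡1 m m-odd = begin
  m ^ 2 % 8        ≡⟨ %-distribˡ-^ m 2 8 ⟩
  (m % 8) ^ 2 % 8  ≡⟨ odd-residues (m % 8) (m%n<n m 8) (trans (m∣n⇒o%n%m≡o%m 2 8 m (divides 4 refl)) m-odd) ⟩
  1                ∎
  where
  odd-residues : ∀ r → r < 8 → r % 2 ≡ 1 → r ^ 2 % 8 ≡ 1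
  odd-residues 1 _ _ = refl
  odd-residues 3 _ _ = refl
  odd-residues 5 _ _ = refl
  odd-residues 7 _ _ = refl
  odd-residues 0 _ ()
  odd-residues 2 _ ()
  odd-residues 4 _ ()
  odd-residues 6 _ ()
  odd-residues (suc (suc (suc (suc (suc (suc (suc (suc _)))))))) (s≤s (s≤s (s≤s (s≤s (s≤s (s≤s (s≤s (s≤s ())))))))) _

^-monoˡ-∣ : ∀ {m n} e → m ∣ n → m ^ e ∣ n ^ e
^-monoˡ-∣ zero    _   = ∣-refl
^-monoˡ-∣ (suc e) m∣n = *-pres-∣ m∣n (^-monoˡ-∣ e m∣n)

^-monoʳ-∣ : ∀ m {n o} → n ≤ o → m ^ n ∣ m ^ o
^-monoʳ-∣ m {n} {o} n≤o = divides (m ^ (o ∸ n)) (begin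
  m ^ o                ≡⟨ cong (m ^_) (m∸n+n≡m n≤o) ⟨
  m ^ (o ∸ n + n)      ≡⟨ ^-distribˡ-+-* m (o ∸ n) n ⟩
  m ^ (o ∸ n) * m ^ n  ∎)

m^k%8≡1∨64∣m^k : ∀ {k} → 2 ∣ k → 6 ≤ k → ∀ m → m ^ k % 8 ≡ 1 ⊎ 64 ∣ m ^ k
m^k%8≡1∨64∣m^k {k} (divides e k≡e*2) 6≤k m with m%2≡0∨m%2≡1 m
... | inj₁ m-even = inj₂ (∣-trans (^-monoˡ-∣ 6 (m%n≡0⇒n∣m m 2 m-even)) (^-monoʳ-∣ m 6≤k))
... | inj₂ m-odd  = inj₁ (begin
  m ^ k % 8        ≡⟨ cong (λ i → m ^ i % 8) k≡e*2 ⟩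
  m ^ (e * 2) % 8  ≡⟨ cong (_% 8) (^-*-assoc m e 2) ⟨
  (m ^ e) ^ 2 % 8  ≡⟨ m%2≡1⇒m^2%8≡1 (m ^ e) (m%2≡1⇒m^e%2≡1 m e m-odd) ⟩
  1                ∎)

module _ {A : Set} (f : A → ℕ) (f-classes : ∀ x → f x % 8 ≡ 1 ⊎ 64 ∣ f x) where

  -- j counts the x with f x % 8 ≡ 1.
  sum%8≡count%8 : ∀ xs → ∃[ j ] (j ≤ length xs × sum (map f xs) % 8 ≡ j % 8 × (j ≡ 0 → 64 ∣ sum (map f xs)))
  sum%8≡count%8 [] = 0 , z≤n , refl , λ _ → divides 0 refl
  sum%8≡count%8 (x ∷ xs) with sum%8≡count%8 xs | f-classes x
  ... | j , j≤ , S≡j , j≡0⇒64∣S | inj₁ fx≡1 = suc j , s≤s j≤ , (begin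
    (f x + sum (map f xs)) % 8  ≡⟨ +-congʳ-% {f x} {1} (sum (map f xs)) 8 fx≡1 ⟩
    (1 + sum (map f xs)) % 8    ≡⟨ +-congˡ-% {sum (map f xs)} {j} 1 8 S≡j ⟩
    suc j % 8                   ∎) , λ ()
  ... | j , j≤ , S≡j , j≡0⇒64∣S | inj₂ 64∣fx =
    j , m≤n⇒m≤1+n j≤ , trans (%-remove-+ˡ (sum (map f xs)) (∣-trans (divides 8 refl) 64∣fx)) S≡j ,
    λ j≡0 → ∣m∣n⇒∣m+n 64∣fx (j≡0⇒64∣S j≡0)

  sum%64≢8 : ∀ xs → length xs < 8 → sum (map f xs) % 64 ≢ 8
  sum%64≢8 xs len<8 S≡8 with sum%8≡count%8 xs
  ... | j , j≤ , S≡j , j≡0⇒64∣S = contradiction (trans (sym S≡8) (n∣m⇒m%n≡0 _ 64 (j≡0⇒64∣S j≡0))) λ ()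
    where
    j≡0 : j ≡ 0
    j≡0 = begin
      j                        ≡⟨ m<n⇒m%n≡m (≤-<-trans j≤ len<8) ⟨
      j % 8                    ≡⟨ S≡j ⟨
      sum (map f xs) % 8       ≡⟨ m∣n⇒o%n%m≡o%m 8 64 (sum (map f xs)) (divides 8 refl) ⟨
      sum (map f xs) % 64 % 8  ≡⟨ cong (_% 8) S≡8 ⟩
      0                        ∎

mod2^-mod2^ : ∀ d n x → mod2^ n (mod2^ (d + n) x) ≡ mod2^ n x
mod2^-mod2^ d n x =
  m∣n⇒o%n%m≡o%m (2 ^ n) (2 ^ (d + n)) x {{m^n≢0 2 n}} {{m^n≢0 2 (d + n)}}
    (divides (2 ^ d) (^-distribˡ-+-* 2 d n))

residue-mod2^ : ∀ (y : ℤ₂) d n → mod2^ n (residue y (d + n)) ≡ residue y n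
residue-mod2^ y zero    n = m<n⇒m%n≡m {{m^n≢0 2 n}} (bounded y n)
residue-mod2^ y (suc d) n = begin
  mod2^ n (residue y (suc d + n))                   ≡⟨ mod2^-mod2^ d n _ ⟨
  mod2^ n (mod2^ (d + n) (residue y (suc d + n)))   ≡⟨ cong (mod2^ n) (coherent y (d + n)) ⟩
  mod2^ n (residue y (d + n))                       ≡⟨ residue-mod2^ y d n ⟩
  residue y n                                       ∎

limit : (a : ℕ → ℕ) → (∀ n → mod2^ n (a (suc n)) ≡ mod2^ n (a n)) → ℤ₂
limit a a-coherent = mkℤ₂
  (λ n → mod2^ n (a n))
  (λ n → m%n<n (a n) (2 ^ n) {{m^n≢0 2 n}})
  (λ n → trans (mod2^-mod2^ 1 n (a (suc n))) (a-coherent n))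

fromℕ : ℕ → ℤ₂
fromℕ m = limit (λ _ → m) (λ _ → refl)

powSumResidue-replicate-1 : ∀ k c n → powSumResidue k (replicate c (fromℕ 1)) n ≡ mod2^ n c
powSumResidue-replicate-1 k zero    n = refl
powSumResidue-replicate-1 k (suc c) n = begin
  mod2^ n (mod2^ n 1 ^ k + S)  ≡⟨ +-congʳ-% S (2 ^ n) (%-distribˡ-^ 1 k (2 ^ n)) ⟨
  mod2^ n (1 ^ k + S)          ≡⟨ cong (λ t → mod2^ n (t + S)) (^-zeroˡ k) ⟩
  mod2^ n (1 + S)              ≡⟨ +-congˡ-% 1 (2 ^ n) (powSumResidue-replicate-1 k c n) ⟩
  mod2^ n (1 + c)              ∎
  where
  instance _ = m^n≢0 2 n
  S = sum (map (λ x → residue x n ^ k) (replicate c (fromℕ 1)))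

powSumResidue-∷-replicate-1 : ∀ k x c n → powSumResidue k (x ∷ replicate c (fromℕ 1)) n ≡ mod2^ n (residue x n ^ k + c)
powSumResidue-∷-replicate-1 k x c n =
  +-congˡ-% (residue x n ^ k) (2 ^ n) {{m^n≢0 2 n}} (powSumResidue-replicate-1 k c n)

binomial-first-order : ∀ u a j → ∃[ s ] (u + a) ^ suc j ≡ u ^ suc j + suc j * a * u ^ j + a * a * s
binomial-first-order u a zero    = 0 , expand u a
  where
  expand : ∀ u a → (u + a) * 1 ≡ u * 1 + 1 * a * 1 + a * a * 0
  expand = solve-∀
binomial-first-order u a (suc j) with binomial-first-order u a j
... | s , expansion = s * u + suc j * u ^ j + a * s , (begin
  (u + a) * (u + a) ^ suc j                               ≡⟨ cong ((u + a) *_) expansion ⟩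
  (u + a) * (u ^ suc j + suc j * a * u ^ j + a * a * s)   ≡⟨ expand u a (u ^ j) s j ⟩
  u * u ^ suc j + suc (suc j) * a * u ^ suc j + a * a * (s * u + suc j * u ^ j + a * s)  ∎)
  where
  expand : ∀ u a U s j → (u + a) * (u * U + suc j * a * U + a * a * s)
         ≡ u * (u * U) + suc (suc j) * a * (u * U) + a * a * (s * u + suc j * U + a * s)
  expand = solve-∀

[u+2^[2+n]]^k≡u^k+2^[3+n] : ∀ k → k % 4 ≡ 2 → ∀ n u → u % 2 ≡ 1 →
                             mod2^ (4 + n) ((u + 2 ^ (2 + n)) ^ k) ≡ mod2^ (4 + n) (u ^ k + 2 ^ (3 + n))
[u+2^[2+n]]^k≡u^k+2^[3+n] k k≡2[4] n u u-odd
  with k / 4 | trans (m≡m%n+[m/n]*n k 4) (cong (_+ k / 4 * 4) k≡2[4])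
... | q | refl with binomial-first-order u (2 ^ (2 + n)) (1 + q * 4)
... | s , expansion = begin
  mod2^ (4 + n) ((u + 2 ^ (2 + n)) ^ k)
    ≡⟨ cong (mod2^ (4 + n)) expansion ⟩
  mod2^ (4 + n) (u ^ k + k * 2 ^ (2 + n) * u ^ j + 2 ^ (2 + n) * 2 ^ (2 + n) * s)
    ≡⟨ cong (λ t → mod2^ (4 + n) (u ^ k + k * 2 ^ (2 + n) * t + 2 ^ (2 + n) * 2 ^ (2 + n) * s)) u^j≡ ⟩
  mod2^ (4 + n) (u ^ k + k * 2 ^ (2 + n) * (1 + v * 2) + 2 ^ (2 + n) * 2 ^ (2 + n) * s)
    ≡⟨ cong (mod2^ (4 + n)) (regroup (u ^ k) (2 ^ n) q v s) ⟩
  mod2^ (4 + n) (u ^ k + 2 ^ (3 + n) + (q + v + 2 * q * v + 2 ^ n * s) * 2 ^ (4 + n))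
    ≡⟨ [m+kn]%n≡m%n (u ^ k + 2 ^ (3 + n)) (q + v + 2 * q * v + 2 ^ n * s) (2 ^ (4 + n)) ⟩
  mod2^ (4 + n) (u ^ k + 2 ^ (3 + n))  ∎
  where
  instance _ = m^n≢0 2 (4 + n)
  j = 1 + q * 4
  v = u ^ j / 2
  u^j≡ : u ^ j ≡ 1 + v * 2
  u^j≡ = trans (m≡m%n+[m/n]*n (u ^ j) 2) (cong (_+ v * 2) (m%2≡1⇒m^e%2≡1 u j u-odd))
  regroup : ∀ X P q v s →
            X + (2 + q * 4) * (2 * (2 * P)) * (1 + v * 2) + 2 * (2 * P) * (2 * (2 * P)) * s
          ≡ X + 2 * (2 * (2 * P)) + (q + v + 2 * q * v + P * s) * (2 * (2 * (2 * (2 * P))))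
  regroup = solve-∀

module HenselLifting (k : ℕ) (k≡2[4] : k % 4 ≡ 2) (y : ℤ₂) (c : ℕ) where

  OddRootMod2^ : ℕ → ℕ → Set
  OddRootMod2^ n u = u % 2 ≡ 1 × mod2^ n (u ^ k + c) ≡ residue y n

  lift : ∀ n ((u , _) : ∃ (OddRootMod2^ (3 + n))) →
         ∃[ v ] (mod2^ (2 + n) v ≡ mod2^ (2 + n) u × OddRootMod2^ (4 + n) v)
  lift n (u , u-odd , u-root)
    with m%n≡o%n⇒m%2n≡o∨[m+n]%2n≡o (2 ^ (3 + n)) {{m^n≢0 2 (3 + n)}}
           (trans u-root (sym (coherent y (3 + n)))) (bounded y (4 + n))
  ... | inj₁ u-root′ = u , refl , u-odd , u-root′
  ... | inj₂ shifted-root =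
    u + 2 ^ (2 + n) ,
    [m+n]%n≡m%n u (2 ^ (2 + n)) {{m^n≢0 2 (2 + n)}} ,
    trans (%-remove-+ʳ u (m∣m*n (2 ^ (1 + n)))) u-odd ,
    (begin
      mod2^ (4 + n) ((u + 2 ^ (2 + n)) ^ k + c)
        ≡⟨ +-congʳ-% c (2 ^ (4 + n)) {{m^n≢0 2 (4 + n)}} ([u+2^[2+n]]^k≡u^k+2^[3+n] k k≡2[4] n u u-odd) ⟩
      mod2^ (4 + n) (u ^ k + 2 ^ (3 + n) + c)
        ≡⟨ cong (mod2^ (4 + n)) (xy∙z≈xz∙y (u ^ k) (2 ^ (3 + n)) c) ⟩
      mod2^ (4 + n) (u ^ k + c + 2 ^ (3 + n))
        ≡⟨ shifted-root ⟩
      residue y (4 + n)  ∎)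

  module _ (base : OddRootMod2^ 3 1) where

    approx : ∀ n → ∃ (OddRootMod2^ (3 + n))
    approx zero    = 1 , base
    approx (suc n) = let (v , _ , v-root) = lift n (approx n) in v , v-root

    root : ℤ₂
    root = limit (λ n → proj₁ (approx n)) λ n → begin
      mod2^ n (proj₁ (approx (suc n)))                     ≡⟨ mod2^-mod2^ 2 n _ ⟨
      mod2^ n (mod2^ (2 + n) (proj₁ (approx (suc n))))     ≡⟨ cong (mod2^ n) (proj₁ (proj₂ (lift n (approx n)))) ⟩
      mod2^ n (mod2^ (2 + n) (proj₁ (approx n)))           ≡⟨ mod2^-mod2^ 2 n _ ⟩
      mod2^ n (proj₁ (approx n))                           ∎

    root-solves : ∀ n → mod2^ n (residue root n ^ k + c) ≡ residue y n
    root-solves n = begin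
      mod2^ n (mod2^ n u ^ k + c)              ≡⟨ +-congʳ-% c (2 ^ n) (%-distribˡ-^ u k (2 ^ n)) ⟨
      mod2^ n (u ^ k + c)                      ≡⟨ mod2^-mod2^ 3 n _ ⟨
      mod2^ n (mod2^ (3 + n) (u ^ k + c))      ≡⟨ cong (mod2^ n) (proj₂ (proj₂ (approx n))) ⟩
      mod2^ n (residue y (3 + n))              ≡⟨ residue-mod2^ y 3 n ⟩
      residue y n                              ∎
      where
      instance _ = m^n≢0 2 n
      u = proj₁ (approx n)

sumOfAtMost-8 : ∀ k → k % 4 ≡ 2 → ∀ y → SumOfAtMost k 8 y
sumOfAtMost-8 k k≡2[4] y =
  root base ∷ replicate c (fromℕ 1) ,
  subst (_≤ 8) (cong suc (sym (length-replicate c))) (m%n<n (r + 7) 8) ,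
  λ n → trans (powSumResidue-∷-replicate-1 k (root base) c n) (root-solves base n)
  where
  r = residue y 3
  c = (r + 7) % 8
  open HenselLifting k k≡2[4] y c
  base : OddRootMod2^ 3 1
  base = refl , (begin
    (1 ^ k + c) % 8      ≡⟨ cong (λ t → (t + c) % 8) (^-zeroˡ k) ⟩
    (1 + c) % 8          ≡⟨ +-congˡ-% {c} {r + 7} 1 8 (m%n%n≡m%n (r + 7) 8) ⟩
    (1 + (r + 7)) % 8    ≡⟨ cong (_% 8) (+-suc r 7) ⟨
    (r + 8) % 8          ≡⟨ [m+n]%n≡m%n r 8 ⟩
    r % 8                ≡⟨ m<n⇒m%n≡m (bounded y 3) ⟩
    r                    ∎)

8∈ℤ₂^k : ∀ k → InPowerSemigroup k (fromℕ 8)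
8∈ℤ₂^k k = replicate 8 (fromℕ 1) , s≤s z≤n , powSumResidue-replicate-1 k 8

8-not-sumOfAtMost : ∀ {k m} → 2 ∣ k → 6 ≤ k → m < 8 → ¬ SumOfAtMost k m (fromℕ 8)
8-not-sumOfAtMost {k} 2∣k 6≤k m<8 (xs , length≤m , xs-sum) =
  sum%64≢8 (λ x → residue x 6 ^ k) (λ x → m^k%8≡1∨64∣m^k 2∣k 6≤k (residue x 6))
    xs (≤-<-trans length≤m m<8) (xs-sum 6)

theorem3p5 : (k : ℕ) → k % 4 ≡ 2 → 6 ≤ k → WaringNumberIs k 8
theorem3p5 k k≡2[4] 6≤k =
  s≤s z≤n ,
  (λ y _ → sumOfAtMost-8 k k≡2[4] y) ,
  (λ m _ m<8 bound → 8-not-sumOfAtMost 2∣k 6≤k m<8 (bound (fromℕ 8) (8∈ℤ₂^k k)))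
  where
  2∣k : 2 ∣ k
  2∣k = ∣n∣m%n⇒∣m (divides 2 refl) (subst (2 ∣_) (sym k≡2[4]) ∣-refl)
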